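{- Let $K\ge 0$ be an integer. Let $G_1,\ldots,G_n$ be nondeterministic automata, where $G_i$ has set of secret states $Q_i^S$, and consider the composed system $G_1\|\cdots\|G_n$ with interaction $\|_\lor$, i.e. with set of secret states $Q^S=Q\setminus(Q_1^{NS}\times\cdots\times Q_n^{NS})$, $Q_i^{NS}=Q_i\setminus Q_i^S$. Let $\sim$ be an opaque observation equivalence on $G_1$ and $\tilde G_1$ the quotient automaton of $G_1$ modulo $\sim$. Then $G_1\|\cdots\|G_n$ is $K$-step opaque if and only if $\tilde G_1\|G_2\|\cdots\|G_n$ is $K$-step opaque (with secret states defined in the same $\|_\lor$ manner).
   Context: An automaton is $G=\langle\Sigma_\tau,Q,\to,Q^\circ\rangle$ with finite set $\Sigma$ of observable events, a special unobservable event $\tau\notin\Sigma$, $\Sigma_\tau=\Sigma\cup\{\tau\}$, finite states $Q$, transitions $\to\subseteq Q\times\Sigma_\tau\times Q$, initial states $Q^\circ$; it carries secret states $Q^S\subseteq Q$ and $Q^{NS}=Q\setminus Q^S$. For $s\in\Sigma^*$, $p\stackrel{s}{\Rightarrow}q$ means there is $t\in\Sigma_\tau^*$ which becomes $s$ after deleting all $\tau$'s and $p\stackrel{t}{\to}q$; $p\stackrel{s}{\Rightarrow}$ means this for some $q$; $L(G,q)=\{s\in\Sigma^*:q\stackrel{s}{\Rightarrow}\}$. Synchronous composition: states are tuples, initial states products of initial states; an event in $\Sigma$ shared by components is executed jointly by all components having it in their alphabet; other events (including $\tau$, never shared) are executed by a single component while the others stay put. $K$-step opacity: $G$ is $K$-step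 opaque w.r.t. $Q^S$ iff for every $q^\circ\in Q^\circ$ and all $s,t\in\Sigma^*$ with $st\in L(G,q^\circ)$, $q^\circ\stackrel{s}{\Rightarrow}Q^S$ and $|t|\le K$, there exist $q'^\circ\in Q^\circ$ and $y\in Q^{NS}$ with $q'^\circ\stackrel{s}{\Rightarrow}y$ and $y\stackrel{t}{\Rightarrow}$. Opaque observation equivalence: an equivalence relation $\sim$ on $Q$ such that whenever $x_1\sim x_2$: (i) if $x_1\stackrel{s}{\Rightarrow}y_1$ for some $s\in\Sigma^*$, then there is $y_2$ with $x_2\stackrel{s}{\Rightarrow}y_2$ and $y_1\sim y_2$; (ii) $x_1\in Q^S$ iff $x_2\in Q^S$. Quotient automaton modulo $\sim$: states are the classes $[x]$, $([x],\sigma,[y])$ is a transition iff $x'\stackrel{\sigma}{\to}y'$ for some $x'\in[x]$, $y'\in[y]$, initial states $\{[x^\circ]:x^\circ\in Q^\circ\}$; a class $[x]$ is secret iff $x\in Q^S$. -}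

module Defs where

open import Data.Nat using (ℕ; suc; _≤_)
open import Data.Fin using (Fin; zero; suc)
open import Data.Fin.Subset using (Subset; _∈_)
open import Data.List using (List; []; _∷_; _++_; length)
open import Data.Product using (Σ; ∃; ∃-syntax; _×_; _,_)
open import Relation.Nullary using (¬_)
open import Relation.Binary.PropositionalEquality using (_≡_)
open import Relation.Binary.Structures using (IsEquivalence)
open import Data.Bool using (Bool)
import Data.Bool
import Data.Vec

-- Events over a global finite set of observable events Σ = Fin k,
-- plus the unobservable event τ.
data Ev (k : ℕ) : Set where
  obs : Fin k → Ev k
  τ   : Ev k

erase : ∀ {k} → List (Ev k) → List (Fin k)
erase [] = []
erase (obs σ ∷ t) = σ ∷ erase t
erase (τ ∷ t) = erase t

-- A (possibly infinite-state) labelled transition system with alphabet,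
-- initial states and secret states.  Used for the composed systems.
record LTS (k : ℕ) : Set₁ where
  field
    State  : Set
    Alph   : Subset k
    Trans  : State → Ev k → State → Set
    Init   : State → Set
    Secret : State → Set

record Automaton (k : ℕ) : Set₁ where
  field
    size   : ℕ
    Alph   : Subset k
    Trans  : Fin size → Ev k → Fin size → Set
    Init   : Fin size → Set
    Secret : Fin size → Set

toLTS : ∀ {k} → Automaton k → LTS k
toLTS G = record
  { State = Fin size ; Alph = Alph ; Trans = Trans ; Init = Init ; Secret = Secret }
  where open Automaton G

module _ {k : ℕ} (L : LTS k) where
  open LTS L

  data Path : State → List (Ev k) → State → Set where
    here  : ∀ {p} → Path p [] p
    there : ∀ {p e q t r} → Trans p e q → Path q t r → Path p (e ∷ t) r

  _⇒[_]_ : State → List (Fin k) → State → Set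
  p ⇒[ s ] q = Σ (List (Ev k)) λ t → erase t ≡ s × Path p t q

  _⇒[_] : State → List (Fin k) → Set
  p ⇒[ s ] = ∃[ q ] (p ⇒[ s ] q)

  KStepOpaque : ℕ → Set
  KStepOpaque K =
    ∀ (q₀ : State) → Init q₀ → ∀ (s t : List (Fin k)) →
    q₀ ⇒[ s ++ t ] →
    (∃[ q ] (q₀ ⇒[ s ] q × Secret q)) →
    length t ≤ K →
    ∃[ q₀' ] ∃[ y ] (Init q₀' × q₀' ⇒[ s ] y × ¬ Secret y × y ⇒[ t ])

record IsOpaqueObsEquiv {k} (G : Automaton k)
         (_∼_ : Fin (Automaton.size G) → Fin (Automaton.size G) → Set) : Set where
  open Automaton G
  field
    isEquivalence : IsEquivalence _∼_
    simulate : ∀ {x₁ x₂} → x₁ ∼ x₂ → ∀ s y₁ → _⇒[_]_ (toLTS G) x₁ s y₁ →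
               ∃[ y₂ ] (_⇒[_]_ (toLTS G) x₂ s y₂ × y₁ ∼ y₂)
    secret-resp : ∀ {x₁ x₂} → x₁ ∼ x₂ → (Secret x₁ → Secret x₂) × (Secret x₂ → Secret x₁)

-- G̃ is (up to renaming of its states) the quotient automaton of G modulo ∼:
-- π sends a state to its class; the classes are exactly the states of G̃.
record IsQuotient {k} (G : Automaton k)
         (_∼_ : Fin (Automaton.size G) → Fin (Automaton.size G) → Set)
         (G̃ : Automaton k) : Set where
  module G = Automaton G
  module H = Automaton G̃
  field
    π          : Fin G.size → Fin H.size
    surjective : ∀ a → ∃[ x ] (π x ≡ a)
    classes    : ∀ x y → (π x ≡ π y → x ∼ y) × (x ∼ y → π x ≡ π y)
    alph       : H.Alph ≡ G.Alph
    trans      : ∀ a e b → (H.Trans a e b → ∃[ x ] ∃[ y ] (π x ≡ a × π y ≡ b × G.Trans x e y))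
                         × (∀ x y → π x ≡ a → π y ≡ b → G.Trans x e y → H.Trans a e b)
    init       : ∀ a → (H.Init a → ∃[ x ] (G.Init x × π x ≡ a))
                       × (∀ x → G.Init x → π x ≡ a → H.Init a)
    secret     : ∀ x → (H.Secret (π x) → G.Secret x) × (G.Secret x → H.Secret (π x))

Compose∨ : ∀ {k n} → (Fin n → Automaton k) → LTS k
Compose∨ {k} {n} G = record
  { State  = (i : Fin n) → Fin (size (G i))
  ; Alph   = Data.Vec.tabulate anyAlph
  ; Trans  = trans
  ; Init   = λ x → ∀ i → Init (G i) (x i)
  ; Secret = λ x → ¬ (∀ i → ¬ Secret (G i) (x i))
  }
  where
  open Automaton
  open import Data.Vec using (lookup)
  anyAlph : Fin k → Bool
  anyAlph σ = Data.Vec.foldr _ Data.Bool._∨_ Data.Bool.false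
                (Data.Vec.tabulate λ i → lookup (Alph (G i)) σ)
  trans : ((i : Fin n) → Fin (size (G i))) → Ev k → ((i : Fin n) → Fin (size (G i))) → Set
  trans x (obs σ) y =
    (∃[ i ] (σ ∈ Alph (G i))) ×
    (∀ i → (σ ∈ Alph (G i) → Trans (G i) (x i) (obs σ) (y i)) ×
           (¬ (σ ∈ Alph (G i)) → y i ≡ x i))
  trans x τ y = ∃[ i ] (Trans (G i) (x i) τ (y i) × (∀ j → ¬ (j ≡ i) → y j ≡ x j))

replace₀ : ∀ {k n} → Automaton k → (Fin (suc n) → Automaton k) → Fin (suc n) → Automaton k
replace₀ H G zero = H
replace₀ H G (suc i) = G (suc i)

module Submission where

-- * Weak paths p =[ s ]⇒ q of an LTS compose, and a weak path with a nonempty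
--   observation splits at its first observable event.
-- * An abstraction of an LTS A by an LTS B is a map abstr : A → B that
--   preserves initial states and transitions, together with a relation x ≈ x̃
--   (x ≈ abstr x) along which initial states and single transitions of B can be
--   matched by weak steps of A, and which respects secrecy.  Weak paths then
--   transfer in both directions, and so does K-step opacity: the observer's
--   runs and the non-secret alternatives are carried over verbatim.
-- * Instance: abstr sends a composite state to the composite state whose first
--   component is its ∼-class.  A quotient transition out of the class of x is
--   matched by a weak step of x (quotient transitions come from some member of
--   the class, and ∼ is a weak simulation); inside the composition, silent
--   moves of the first component lift componentwise, and an observable joint
--   move is split as τ* σ τ* in the first component.

open import Defs
open import Data.Nat using (ℕ; suc)
open import Data.Fin using (Fin; zero; suc)
open import Data.Fin.Subset using (_∈_)
open import Data.Fin.Subset.Properties using (_∈?_)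
open import Data.List using (List; []; _∷_; _++_)
open import Data.Product using (∃-syntax; _×_; _,_; proj₁; proj₂)
open import Data.Empty using (⊥-elim)
open import Relation.Nullary using (¬_; yes; no)
open import Relation.Binary.PropositionalEquality
  using (_≡_; refl; sym; trans; cong; subst)
open import Function.Bundles using (_⇔_; mk⇔)

erase-++ : ∀ {k} (t u : List (Ev k)) → erase (t ++ u) ≡ erase t ++ erase u
erase-++ []          u = refl
erase-++ (obs σ ∷ t) u = cong (σ ∷_) (erase-++ t u)
erase-++ (τ ∷ t)     u = erase-++ t u

module WeakPaths {k : ℕ} (L : LTS k) where
  open LTS L

  infix 4 _=[_]⇒_
  _=[_]⇒_ : State → List (Fin k) → State → Set
  p =[ s ]⇒ q = _⇒[_]_ L p s q

  path-++ : ∀ {p t q u r} → Path L p t q → Path L q u r → Path L p (t ++ u) r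
  path-++ here         Q = Q
  path-++ (there tr P) Q = there tr (path-++ P Q)

  ⇒-refl : ∀ {p} → p =[ [] ]⇒ p
  ⇒-refl = [] , refl , here

  ⇒-step : ∀ {p e q} → Trans p e q → p =[ erase (e ∷ []) ]⇒ q
  ⇒-step {e = e} tr = e ∷ [] , refl , there tr here

  ⇒-++ : ∀ {p s q u r} → p =[ s ]⇒ q → q =[ u ]⇒ r → p =[ s ++ u ]⇒ r
  ⇒-++ (t , refl , P) (t' , refl , P') = t ++ t' , erase-++ t t' , path-++ P P'

  ⇒-split : ∀ {p σ s q} → p =[ σ ∷ s ]⇒ q →
            ∃[ u ] ∃[ u' ] (p =[ [] ]⇒ u × Trans u (obs σ) u' × u' =[ s ]⇒ q)
  ⇒-split ([] , () , _)
  ⇒-split (obs _ ∷ t , refl , there tr P) = _ , _ , ⇒-refl , tr , (t , refl , P)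
  ⇒-split (τ ∷ t , eq , there tr P) with ⇒-split (t , eq , P)
  ... | u , u' , (t₁ , e₁ , P₁) , tr' , rest = u , u' , (τ ∷ t₁ , e₁ , there tr P₁) , tr' , rest

record Abstraction {k : ℕ} (A B : LTS k) : Set₁ where
  module A = LTS A
  module B = LTS B
  open WeakPaths A using (_=[_]⇒_)
  field
    abstr         : A.State → B.State
    _≈_           : A.State → B.State → Set
    ≈-abstr       : ∀ x → x ≈ abstr x
    abstr-init    : ∀ {x} → A.Init x → B.Init (abstr x)
    abstr-step    : ∀ {x e y} → A.Trans x e y → B.Trans (abstr x) e (abstr y)
    concrete-init : ∀ {x̃} → B.Init x̃ → ∃[ x ] (A.Init x × x ≈ x̃)
    concrete-step : ∀ {x̃ e ỹ x} → B.Trans x̃ e ỹ → x ≈ x̃ →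
                    ∃[ y ] (x =[ erase (e ∷ []) ]⇒ y × y ≈ ỹ)
    secret-≈      : ∀ {x x̃} → x ≈ x̃ → (A.Secret x → B.Secret x̃) × (B.Secret x̃ → A.Secret x)

module AbstractionOpacity {k : ℕ} {A B : LTS k} (abs : Abstraction A B) where
  open Abstraction abs
  open WeakPaths A using (⇒-refl; ⇒-++) renaming (_=[_]⇒_ to _=[_]⇒ᴬ_)
  open WeakPaths B using () renaming (_=[_]⇒_ to _=[_]⇒ᴮ_)

  abstr-path : ∀ {x t y} → Path A x t y → Path B (abstr x) t (abstr y)
  abstr-path here         = here
  abstr-path (there tr P) = there (abstr-step tr) (abstr-path P)

  abstr-⇒ : ∀ {x s y} → x =[ s ]⇒ᴬ y → abstr x =[ s ]⇒ᴮ abstr y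
  abstr-⇒ (t , e , P) = t , e , abstr-path P

  concrete-path : ∀ {x̃ t ỹ x} → Path B x̃ t ỹ → x ≈ x̃ → ∃[ y ] (x =[ erase t ]⇒ᴬ y × y ≈ ỹ)
  concrete-path here x≈ = _ , ⇒-refl , x≈
  concrete-path {t = e ∷ t} {x = x} (there tr P) x≈ with concrete-step tr x≈
  ... | y₁ , x⇒y₁ , y₁≈ with concrete-path P y₁≈
  ... | y , y₁⇒y , y≈ =
    y , subst (λ s → x =[ s ]⇒ᴬ y) (sym (erase-++ (e ∷ []) t)) (⇒-++ x⇒y₁ y₁⇒y) , y≈

  concrete-⇒ : ∀ {x̃ s ỹ x} → x̃ =[ s ]⇒ᴮ ỹ → x ≈ x̃ → ∃[ y ] (x =[ s ]⇒ᴬ y × y ≈ ỹ)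
  concrete-⇒ (t , refl , P) = concrete-path P

  -- A secret run of B is concretised, A supplies a non-secret alternative,
  -- and its abstraction is the alternative required in B.
  opacity-A→B : ∀ K → KStepOpaque A K → KStepOpaque B K
  opacity-A→B K opA q̃₀ ini s t (_ , run) (q̃ , toSecret , sec) len =
    let q₀ , ini₀ , q₀≈ = concrete-init ini
        _ , run′ , _ = concrete-⇒ run q₀≈
        q , toSecret′ , q≈ = concrete-⇒ toSecret q₀≈
        q₀′ , y , ini′ , toY , nonsecret , (_ , cont) =
          opA q₀ ini₀ s t (_ , run′) (q , toSecret′ , proj₂ (secret-≈ q≈) sec) len
    in abstr q₀′ , abstr y , abstr-init ini′ , abstr-⇒ toY
     , (λ sec′ → nonsecret (proj₂ (secret-≈ (≈-abstr y)) sec′)) , (_ , abstr-⇒ cont)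

  -- A secret run of A is abstracted, B supplies a non-secret alternative,
  -- and concretising it gives the alternative required in A.
  opacity-B→A : ∀ K → KStepOpaque B K → KStepOpaque A K
  opacity-B→A K opB q₀ ini s t (_ , run) (q , toSecret , sec) len =
    let q̃₀′ , ỹ , ini′ , toỸ , nonsecret , (_ , cont) =
          opB (abstr q₀) (abstr-init ini) s t (_ , abstr-⇒ run)
              (abstr q , abstr-⇒ toSecret , proj₁ (secret-≈ (≈-abstr q)) sec) len
        q₀′ , ini₀′ , q₀′≈ = concrete-init ini′
        y , toY , y≈ = concrete-⇒ toỸ q₀′≈
        _ , cont′ , _ = concrete-⇒ cont y≈
    in q₀′ , y , ini₀′ , toY , (λ sec′ → nonsecret (proj₁ (secret-≈ y≈) sec′)) , (_ , cont′)

  opacity-⇔ : ∀ K → KStepOpaque A K ⇔ KStepOpaque B K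
  opacity-⇔ K = mk⇔ (opacity-A→B K) (opacity-B→A K)

open Automaton

-- A transition of the quotient out of the class of x is matched by a weak
-- step of x into the target class: the transition stems from some member x′
-- of the class of x, and x weakly simulates x′ since x′ ∼ x.
module _ {k : ℕ} {G G̃ : Automaton k} {_∼_ : Fin (size G) → Fin (size G) → Set}
         (oe : IsOpaqueObsEquiv G _∼_) (iq : IsQuotient G _∼_ G̃) where
  open IsQuotient iq using (π; classes) renaming (trans to quotient-trans)
  open IsOpaqueObsEquiv oe using (simulate)
  open WeakPaths (toLTS G) using (_=[_]⇒_; ⇒-step)

  quotient-step-lift : ∀ {a e b x} → Trans G̃ a e b → π x ≡ a →
                       ∃[ y ] (x =[ erase (e ∷ []) ]⇒ y × π y ≡ b)
  quotient-step-lift {a} {e} {b} {x} tr πx≡a with proj₁ (quotient-trans a e b) tr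
  ... | x′ , y′ , πx′≡a , πy′≡b , tr′ with
        simulate (proj₁ (classes x′ x) (trans πx′≡a (sym πx≡a))) (erase (e ∷ [])) y′ (⇒-step tr′)
  ... | y , x⇒y , y′∼y = y , x⇒y , trans (sym (proj₂ (classes y′ y) y′∼y)) πy′≡b

module FirstComponent {k n : ℕ} (G : Fin (suc n) → Automaton k) where
  open WeakPaths (Compose∨ G) using (_=[_]⇒_; ⇒-step; ⇒-++; ⇒-refl)
  open WeakPaths (toLTS (G zero)) using () renaming (_=[_]⇒_ to _=[_]⇒₀_)

  set₀ : LTS.State (Compose∨ G) → Fin (size (G zero)) → LTS.State (Compose∨ G)
  set₀ x v zero    = v
  set₀ x v (suc j) = x (suc j)

  set₀-τ-step : ∀ {x v} → Trans (G zero) (x zero) τ v → LTS.Trans (Compose∨ G) x τ (set₀ x v)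
  set₀-τ-step tr = zero , tr , others
    where
    others : ∀ {x v} j → ¬ j ≡ zero → set₀ x v j ≡ x j
    others zero    j≢0 = ⊥-elim (j≢0 refl)
    others (suc j) _   = refl

  lift-silent₀ : ∀ {u v} {x : LTS.State (Compose∨ G)} → u =[ [] ]⇒₀ v → x zero ≡ u →
                 ∃[ z ] (x =[ [] ]⇒ z × z zero ≡ v × ∀ j → z (suc j) ≡ x (suc j))
  lift-silent₀ ([] , _ , here) x₀≡u = _ , ⇒-refl , x₀≡u , λ _ → refl
  lift-silent₀ (obs _ ∷ _ , () , _)
  lift-silent₀ {x = x} (τ ∷ t , e , there {q = v} tr P) refl
    with lift-silent₀ {x = set₀ x v} (t , e , P) refl
  ... | z , x′⇒z , z₀≡ , z≡ = z , ⇒-++ (⇒-step {e = τ} (set₀-τ-step {x} tr)) x′⇒z , z₀≡ , z≡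

module ReplaceFirst {k n : ℕ} (G : Fin (suc n) → Automaton k)
    {_∼_ : Fin (size (G zero)) → Fin (size (G zero)) → Set}
    (oe : IsOpaqueObsEquiv (G zero) _∼_) (G̃ : Automaton k) (iq : IsQuotient (G zero) _∼_ G̃) where

  H : Fin (suc n) → Automaton k
  H = replace₀ G̃ G

  open IsQuotient iq using (π; init; secret) renaming (trans to quotient-trans)
  open FirstComponent G using (lift-silent₀)
  open WeakPaths (Compose∨ G) using (_=[_]⇒_; ⇒-step; ⇒-++)
  module GC = LTS (Compose∨ G)
  module HC = LTS (Compose∨ H)

  same-alph : ∀ i → Alph (G i) ≡ Alph (H i)
  same-alph zero    = sym (IsQuotient.alph iq)
  same-alph (suc i) = refl

  to-alph-H : ∀ {σ} i → σ ∈ Alph (G i) → σ ∈ Alph (H i)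
  to-alph-H {σ} i = subst (σ ∈_) (same-alph i)

  to-alph-G : ∀ {σ} i → σ ∈ Alph (H i) → σ ∈ Alph (G i)
  to-alph-G {σ} i = subst (σ ∈_) (sym (same-alph i))

  collapse : GC.State → HC.State
  collapse x zero    = π (x zero)
  collapse x (suc j) = x (suc j)

  _≈_ : GC.State → HC.State → Set
  x ≈ x̃ = π (x zero) ≡ x̃ zero × ∀ j → x (suc j) ≡ x̃ (suc j)

  with₀ : Fin (size (G zero)) → HC.State → GC.State
  with₀ u x̃ zero    = u
  with₀ u x̃ (suc j) = x̃ (suc j)

  -- ≈-related states agree on which components are non-secret, since the
  -- quotient inherits the secret states of G zero classwise.
  nonsecret-G→H : ∀ {x x̃} → x ≈ x̃ → (∀ i → ¬ Secret (G i) (x i)) → (∀ i → ¬ Secret (H i) (x̃ i))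
  nonsecret-G→H (x₀≈ , _)  ns zero    s = ns zero (proj₁ (secret _) (subst (Secret G̃) (sym x₀≈) s))
  nonsecret-G→H (_ , xs≡) ns (suc j) s = ns (suc j) (subst (Secret (G (suc j))) (sym (xs≡ j)) s)

  nonsecret-H→G : ∀ {x x̃} → x ≈ x̃ → (∀ i → ¬ Secret (H i) (x̃ i)) → (∀ i → ¬ Secret (G i) (x i))
  nonsecret-H→G (x₀≈ , _)  ns zero    s = ns zero (subst (Secret G̃) x₀≈ (proj₂ (secret _) s))
  nonsecret-H→G (_ , xs≡) ns (suc j) s = ns (suc j) (subst (Secret (G (suc j))) (xs≡ j) s)

  secret-≈ : ∀ {x x̃} → x ≈ x̃ → (GC.Secret x → HC.Secret x̃) × (HC.Secret x̃ → GC.Secret x)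
  secret-≈ x≈ = (λ s ns → s (nonsecret-H→G x≈ ns)) , (λ s ns → s (nonsecret-G→H x≈ ns))

  collapse-init : ∀ {x} → GC.Init x → HC.Init (collapse x)
  collapse-init {x} ini zero    = proj₂ (init (π (x zero))) (x zero) (ini zero) refl
  collapse-init     ini (suc j) = ini (suc j)

  concrete-init : ∀ {x̃} → HC.Init x̃ → ∃[ x ] (GC.Init x × x ≈ x̃)
  concrete-init {x̃} ini with proj₁ (init (x̃ zero)) (ini zero)
  ... | u , iniᵤ , πu≡ = with₀ u x̃ , ini′ , πu≡ , λ _ → refl
    where
    ini′ : GC.Init (with₀ u x̃)
    ini′ zero    = iniᵤ
    ini′ (suc j) = ini (suc j)

  -- collapse maps transitions to transitions, because the quotient contains the
  -- image of every transition of G zero.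
  quotient-step : ∀ {x e y} → Trans (G zero) x e y → Trans G̃ (π x) e (π y)
  quotient-step {x} {e} {y} = proj₂ (quotient-trans (π x) e (π y)) x y refl refl

  collapse-step : ∀ {x e y} → GC.Trans x e y → HC.Trans (collapse x) e (collapse y)
  collapse-step {x} {obs σ} {y} ((i , σ∈) , moves) = (i , to-alph-H i σ∈) , moves′
    where
    moves′ : ∀ i → (σ ∈ Alph (H i) → Trans (H i) (collapse x i) (obs σ) (collapse y i))
                 × (¬ σ ∈ Alph (H i) → collapse y i ≡ collapse x i)
    moves′ zero    = (λ σ∈ → quotient-step (proj₁ (moves zero) (to-alph-G zero σ∈)))
                   , (λ σ∉ → cong π (proj₂ (moves zero) (λ σ∈ → σ∉ (to-alph-H zero σ∈))))
    moves′ (suc j) = moves (suc j)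
  collapse-step {x} {τ} {y} (zero , tr , stay) = zero , quotient-step tr , stay′
    where
    stay′ : ∀ j → ¬ j ≡ zero → collapse y j ≡ collapse x j
    stay′ zero    j≢0 = ⊥-elim (j≢0 refl)
    stay′ (suc j) j≢0 = stay (suc j) j≢0
  collapse-step {x} {τ} {y} (suc i , tr , stay) = suc i , tr , stay′
    where
    stay′ : ∀ j → ¬ j ≡ suc i → collapse y j ≡ collapse x j
    stay′ zero    j≢i = cong π (stay zero j≢i)
    stay′ (suc j) j≢i = stay (suc j) j≢i

  joint-obs-step : ∀ {x x̃ z̃ σ u} → HC.Trans x̃ (obs σ) z̃ → (∀ j → x (suc j) ≡ x̃ (suc j)) →
                   (σ ∈ Alph (G zero) → Trans (G zero) (x zero) (obs σ) u) →
                   (¬ σ ∈ Alph (G zero) → u ≡ x zero) →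
                   GC.Trans x (obs σ) (with₀ u z̃)
  joint-obs-step {x} {x̃} {z̃} {σ} {u} ((i , σ∈) , moves) xs≡ move₀ stay₀ = (i , to-alph-G i σ∈) , moves′
    where
    moves′ : ∀ i → (σ ∈ Alph (G i) → Trans (G i) (x i) (obs σ) (with₀ u z̃ i))
                 × (¬ σ ∈ Alph (G i) → with₀ u z̃ i ≡ x i)
    moves′ zero    = move₀ , stay₀
    moves′ (suc j) = (λ σ∈ → subst (λ a → Trans (G (suc j)) a (obs σ) (z̃ (suc j)))
                                   (sym (xs≡ j)) (proj₁ (moves (suc j)) σ∈))
                   , (λ σ∉ → trans (proj₂ (moves (suc j)) σ∉) (sym (xs≡ j)))

  other-τ-step : ∀ {x : GC.State} {x̃ z̃ : HC.State} {i} → Trans (G (suc i)) (x̃ (suc i)) τ (z̃ (suc i)) →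
                 (∀ j → ¬ j ≡ suc i → z̃ j ≡ x̃ j) → (∀ j → x (suc j) ≡ x̃ (suc j)) →
                 GC.Trans x τ (with₀ (x zero) z̃)
  other-τ-step {x} {x̃} {z̃} {i} tr stay xs≡ =
    suc i , subst (λ a → Trans (G (suc i)) a τ (z̃ (suc i))) (sym (xs≡ i)) tr , stay′
    where
    stay′ : ∀ j → ¬ j ≡ suc i → with₀ (x zero) z̃ j ≡ x j
    stay′ zero    _   = refl
    stay′ (suc j) j≢i = trans (stay (suc j) j≢i) (sym (xs≡ j))

  -- A joint σ-move in which the first component takes part: its quotient move
  -- is matched by τ* σ τ* in G zero, which lifts as silent moves around one
  -- joint σ-move.
  concrete-joint-step : ∀ {x̃ σ z̃ x} → HC.Trans x̃ (obs σ) z̃ → σ ∈ Alph (G zero) → x ≈ x̃ →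
                        ∃[ z ] (x =[ σ ∷ [] ]⇒ z × z ≈ z̃)
  concrete-joint-step {σ = σ} {z̃} st@(_ , moves) σ∈ (x₀≈ , xs≡)
    with quotient-step-lift oe iq (proj₁ (moves zero) (to-alph-H zero σ∈)) x₀≈
  ... | y₀ , x₀⇒y₀ , πy₀≡ with WeakPaths.⇒-split (toLTS (G zero)) x₀⇒y₀
  ... | u , u′ , x₀⇒u , tr , u′⇒y₀ with lift-silent₀ x₀⇒u refl
  ... | x₁ , x⇒x₁ , x₁₀≡u , x₁s≡ with lift-silent₀ {x = with₀ u′ z̃} u′⇒y₀ refl
  ... | z , x₂⇒z , z₀≡y₀ , zs≡ = z , ⇒-++ x⇒x₁ (⇒-++ (⇒-step {e = obs σ} joint) x₂⇒z)
                                  , trans (cong π z₀≡y₀) πy₀≡ , zs≡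
    where
    joint : GC.Trans x₁ (obs σ) (with₀ u′ z̃)
    joint = joint-obs-step st (λ j → trans (x₁s≡ j) (xs≡ j))
              (λ _ → subst (λ a → Trans (G zero) a (obs σ) u′) (sym x₁₀≡u) tr)
              (λ σ∉ → ⊥-elim (σ∉ σ∈))

  concrete-step : ∀ {x̃ e z̃ x} → HC.Trans x̃ e z̃ → x ≈ x̃ →
                  ∃[ z ] (x =[ erase (e ∷ []) ]⇒ z × z ≈ z̃)
  concrete-step {e = τ} (zero , tr , stay) (x₀≈ , xs≡)
    with quotient-step-lift oe iq tr x₀≈
  ... | y₀ , x₀⇒y₀ , πy₀≡ with lift-silent₀ x₀⇒y₀ refl
  ... | z , x⇒z , z₀≡y₀ , zs≡ =
    z , x⇒z , trans (cong π z₀≡y₀) πy₀≡ , λ j → trans (zs≡ j) (trans (xs≡ j) (sym (stay (suc j) λ ())))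
  concrete-step {e = τ} {z̃} {x} (suc i , tr , stay) (x₀≈ , xs≡) =
    with₀ (x zero) z̃ , ⇒-step {e = τ} (other-τ-step tr stay xs≡)
    , trans x₀≈ (sym (stay zero λ ())) , λ _ → refl
  concrete-step {e = obs σ} st x≈ with σ ∈? Alph (G zero)
  ... | yes σ∈ = concrete-joint-step st σ∈ x≈
  concrete-step {e = obs σ} {z̃} {x} st@(_ , moves) (x₀≈ , xs≡) | no σ∉ =
    with₀ (x zero) z̃ , ⇒-step {e = obs σ} (joint-obs-step st xs≡ (λ σ∈ → ⊥-elim (σ∉ σ∈)) (λ _ → refl))
    , trans x₀≈ (sym (proj₂ (moves zero) (λ σ∈ → σ∉ (to-alph-G zero σ∈)))) , λ _ → refl

  abstraction : Abstraction (Compose∨ G) (Compose∨ H)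
  abstraction = record
    { abstr         = collapse
    ; _≈_           = _≈_
    ; ≈-abstr       = λ x → refl , λ _ → refl
    ; abstr-init    = collapse-init
    ; abstr-step    = collapse-step
    ; concrete-init = concrete-init
    ; concrete-step = concrete-step
    ; secret-≈      = secret-≈
    }

theorem7 : ∀ {k n : ℕ} (K : ℕ) (G : Fin (suc n) → Automaton k)
    (_∼_ : Fin (Automaton.size (G zero)) → Fin (Automaton.size (G zero)) → Set)
    → IsOpaqueObsEquiv (G zero) _∼_
    → (G̃ : Automaton k) → IsQuotient (G zero) _∼_ G̃
    → KStepOpaque (Compose∨ G) K ⇔ KStepOpaque (Compose∨ (replace₀ G̃ G)) K
theorem7 K G _∼_ oe G̃ iq = AbstractionOpacity.opacity-⇔ (ReplaceFirst.abstraction G oe G̃ iq) K
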